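{- Let $\mathbf{M}$ be an infinite structure and let $\mathcal{C}\subseteq\mathrm{BRO}(\mathbf{M})$ be such that $\mathbf{M}$ admits $\mathcal{C}$-envelopes. Then $\mathbf{M}^{*\mathcal{C}}$ satisfies the infinite Ramsey theorem.
   Context: Fix a relational language $\mathbb{L}$ (with an unlimited supply of relation symbols of each arity): each symbol $R$ has an arity $n_R\ge1$. A structure $\mathbf{A}$ consists of a set $A$ and subsets $R^{\mathbf{A}}\subseteq A^{n_R}$; $\mathcal{L}_{\mathbf{A}}=\{R: R^{\mathbf{A}}\neq\emptyset\}$. An embedding $f:\mathbf{A}\to\mathbf{B}$ is an injection $A\to B$ with $(a_0,\dots,a_{n-1})\in R^{\mathbf{A}}$ iff $(f(a_0),\dots,f(a_{n-1}))\in R^{\mathbf{B}}$ for all $R$; $\mathrm{Emb}(\mathbf{A},\mathbf{B})$ is the set of embeddings, $\mathrm{Emb}(\mathbf{K})=\mathrm{Emb}(\mathbf{K},\mathbf{K})$, $\mathrm{Age}(\mathbf{K})$ the class of finite structures embeddable in $\mathbf{K}$. A natural number $n$ is identified with $\{0,\dots,n-1\}$; a structure $\mathbf{A}$ is enumerated if $A=\{0,\dots,|A|-1\}$. For infinite $\mathbf{K}$ and $\mathbf{A}\in\mathrm{Age}(\mathbf{K})$, $\mathrm{BRD}(\mathbf{A},\mathbf{K})$ is the least $t<\omega$ such that for all $r<\omega$ and $\chi:\mathrm{Emb}(\mathbf{A},\mathbf{K})\to r$ there is $g\in\mathrm{Emb}(\mathbf{K})$ with $|\chi[g\circ\mathrm{Emb}(\mathbf{A},\mathbf{K})]|\le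 t$ ($\infty$ if none); $\mathrm{BRO}(\mathbf{K})=\{\mathbf{A}\in\mathrm{Age}(\mathbf{K}):\mathrm{BRD}(\mathbf{A},\mathbf{K})=1\}$; $\mathbf{K}$ satisfies the infinite Ramsey theorem if $\mathrm{BRO}(\mathbf{K})=\mathrm{Age}(\mathbf{K})$. Envelopes: for a set $\mathcal{C}$ of finite structures and a finite structure $\mathbf{A}$, a $\mathcal{C}$-extension of $\mathbf{A}$ is a pair $(f,\mathbf{B})$ with $\mathbf{B}\in\mathcal{C}$ and $f\in\mathrm{Emb}(\mathbf{A},\mathbf{B})$; these are preordered by $(f_0,\mathbf{B}_0)\le(f_1,\mathbf{B}_1)$ iff there is $g\in\mathrm{Emb}(\mathbf{B}_0,\mathbf{B}_1)$ with $f_1=g\circ f_0$; a $\mathcal{C}$-envelope of $\mathbf{A}$ is a $\le$-minimal $\mathcal{C}$-extension. For an infinite $\mathbf{M}$ with $\mathbf{A}\in\mathrm{Age}(\mathbf{M})$ and $\mathcal{C}\subseteq\mathrm{Age}(\mathbf{M})$, $g\in\mathrm{Emb}(\mathbf{A},\mathbf{M})$ realizes $(f,\mathbf{B})$ if $g=h\circ f$ for some $h\in\mathrm{Emb}(\mathbf{B},\mathbf{M})$. $\mathbf{M}$ admits $\mathcal{C}$-envelopes if for every $\mathbf{A}\in\mathrm{Age}(\mathbf{M})$ and every $g\in\mathrm{Emb}(\mathbf{A},\mathbf{M})$, $g$ realizes a $\mathcal{C}$-envelope of $\mathbf{A}$ which is unique up to isomorphism (where $(f,\mathbf{B})\cong(f',\mathbf{B}')$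 if there is an isomorphism $\sigma:\mathbf{B}\to\mathbf{B}'$ with $\sigma\circ f=f'$). In that case $\mathbf{M}^{*\mathcal{C}}$ is the expansion of $\mathbf{M}$ obtained by adding, for each enumerated $\mathbf{A}\in\mathrm{Age}(\mathbf{M})$ and each $\mathcal{C}$-envelope $(f,\mathbf{B})$ of $\mathbf{A}$, a new $|A|$-ary relation symbol $R_{(f,\mathbf{B})}$ (distinct and not in $\mathcal{L}_{\mathbf{M}}$), interpreted so that $(a_0,\dots,a_{|A|-1})\in R_{(f,\mathbf{B})}$ iff the map $i\mapsto a_i$ is in $\mathrm{Emb}(\mathbf{A},\mathbf{M})$ and realizes $(f,\mathbf{B})$. -}

module Defs where

open import Level using (Level; _⊔_) renaming (suc to lsuc; zero to lzero)
open import Data.Nat using (ℕ; _≤_)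
open import Data.Fin using (Fin)
open import Data.Product using (Σ; _×_; _,_; proj₁; proj₂)
open import Data.Sum using (_⊎_; inj₁; inj₂)
open import Function using (_∘_; _↔_)
open import Relation.Binary.PropositionalEquality using (_≡_)
open import Relation.Nullary using (¬_)

record Language (ℓ : Level) : Set (lsuc ℓ) where
  field
    Sym   : Set ℓ
    arity : Sym → ℕ
open Language public

record Structure {ℓ a} (L : Language ℓ) (X : Set a) : Set (ℓ ⊔ a ⊔ lsuc lzero) where
  field
    rel : (R : Sym L) → (Fin (arity L R) → X) → Set
open Structure public

FinStr : ∀ {ℓ} → Language ℓ → Set (ℓ ⊔ lsuc lzero)
FinStr L = Σ ℕ λ n → Structure L (Fin n)

module _ {ℓ : Level} {L : Language ℓ} where

  IsEmb : ∀ {a b} {X : Set a} {Y : Set b} →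
          Structure L X → Structure L Y → (X → Y) → Set (ℓ ⊔ a ⊔ b)
  IsEmb {X = X} SX SY f =
    (∀ x y → f x ≡ f y → x ≡ y) ×
    (∀ (R : Sym L) (t : Fin (arity L R) → X) →
       (rel SX R t → rel SY R (f ∘ t)) × (rel SY R (f ∘ t) → rel SX R t))

  Emb : ∀ {a b} {X : Set a} {Y : Set b} →
        Structure L X → Structure L Y → Set (ℓ ⊔ a ⊔ b)
  Emb {X = X} {Y = Y} SX SY = Σ (X → Y) (IsEmb SX SY)

  _∘E_ : ∀ {a b c} {X : Set a} {Y : Set b} {Z : Set c}
           {SX : Structure L X} {SY : Structure L Y} {SZ : Structure L Z} →
         Emb SY SZ → Emb SX SY → Emb SX SZ
  (g , gi , gp) ∘E (f , fi , fp) =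
    (g ∘ f) ,
    (λ x y e → fi x y (gi (f x) (f y) e)) ,
    (λ R t → (λ r → proj₁ (gp R (f ∘ t)) (proj₁ (fp R t) r)) ,
             (λ r → proj₂ (fp R t) (proj₂ (gp R (f ∘ t)) r)))

  Age : ∀ {a} {X : Set a} → Structure L X → FinStr L → Set (ℓ ⊔ a)
  Age SK (n , SA) = Emb SA SK

  -- An r-colouring of Emb(A,K).  Emb(A,K) is a *set of maps*, so the
  -- colouring may only depend on the underlying map.
  Colouring : ∀ {a} {X : Set a} → FinStr L → Structure L X → ℕ → Set (ℓ ⊔ a)
  Colouring (n , SA) SK r =
    Σ (Emb SA SK → Fin r) λ χ →
      ∀ e e' → (∀ x → proj₁ e x ≡ proj₁ e' x) → χ e ≡ χ e'

  -- "for all r and χ : Emb(A,K) → r there is g ∈ Emb(K) with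
  --  |χ[g ∘ Emb(A,K)]| ≤ t"  (the image is covered by t colours)
  BRDAtMost : ∀ {a} {X : Set a} → ℕ → FinStr L → Structure L X → Set (ℓ ⊔ a)
  BRDAtMost t (n , SA) SK =
    ∀ (r : ℕ) (χ : Colouring (n , SA) SK r) →
      Σ (Emb SK SK) λ g →
        Σ (Fin t → Fin r) λ c →
          ∀ (e : Emb SA SK) → Σ (Fin t) λ i → proj₁ χ (_∘E_ {SX = SA} {SY = SK} {SZ = SK} g e) ≡ c i

  BRDisOne : ∀ {a} {X : Set a} → FinStr L → Structure L X → Set (ℓ ⊔ a)
  BRDisOne A SK = BRDAtMost 1 A SK × ¬ BRDAtMost 0 A SK

  BRO : ∀ {a} {X : Set a} → Structure L X → FinStr L → Set (ℓ ⊔ a)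
  BRO SK A = Age SK A × BRDisOne A SK

  InfiniteRamsey : ∀ {a} {X : Set a} → Structure L X → Set (ℓ ⊔ a ⊔ lsuc lzero)
  InfiniteRamsey SK = ∀ (A : FinStr L) → Age SK A → BRO SK A

  Ext : (FinStr L → Set) → FinStr L → Set (ℓ ⊔ lsuc lzero)
  Ext C (n , SA) = Σ (FinStr L) λ B → C B × Emb SA (proj₂ B)

  _≤Ext_ : ∀ {C A} → Ext C A → Ext C A → Set ℓ
  ((m₀ , B₀) , _ , f₀) ≤Ext ((m₁ , B₁) , _ , f₁) =
    Σ (Emb B₀ B₁) λ g → ∀ x → proj₁ f₁ x ≡ proj₁ g (proj₁ f₀ x)

  IsEnvelope : (C : FinStr L → Set) (A : FinStr L) → Ext C A → Set (ℓ ⊔ lsuc lzero)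
  IsEnvelope C A e = ∀ (e' : Ext C A) → e' ≤Ext e → e ≤Ext e'

  _≅Ext_ : ∀ {C A} → Ext C A → Ext C A → Set ℓ
  ((m , B) , _ , f) ≅Ext ((m' , B') , _ , f') =
    Σ (Emb B B') λ σ →
      (∀ y → Σ (Fin m) λ x → proj₁ σ x ≡ y) ×
      (∀ x → proj₁ σ (proj₁ f x) ≡ proj₁ f' x)

  Realizes : ∀ {a} {X : Set a} (SM : Structure L X) {C : FinStr L → Set} {A : FinStr L} →
             (Fin (proj₁ A) → X) → Ext C A → Set (ℓ ⊔ a)
  Realizes SM g ((m , B) , _ , f) =
    Σ (Emb B SM) λ h → ∀ x → g x ≡ proj₁ h (proj₁ f x)

  AdmitsEnvelopes : ∀ {a} {X : Set a} → Structure L X → (FinStr L → Set) →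
                    Set (ℓ ⊔ a ⊔ lsuc lzero)
  AdmitsEnvelopes SM C =
    ∀ (A : FinStr L) → Age SM A → ∀ (g : Emb (proj₂ A) SM) →
      (Σ (Ext C A) λ e → IsEnvelope C A e × Realizes SM (proj₁ g) e) ×
      (∀ (e e' : Ext C A) → IsEnvelope C A e → IsEnvelope C A e' →
         Realizes SM (proj₁ g) e → Realizes SM (proj₁ g) e' → e ≅Ext e')

module _ {L : Language lzero} {X : Set} (SM : Structure L X) (C : FinStr L → Set) where

  -- new symbols R_(f,B): one for each enumerated A ∈ Age(M) and each
  -- C-envelope (f,B) of A; its arity is |A|.
  EnvSym : Set₁
  EnvSym = Σ ℕ λ n → Σ (Structure L (Fin n)) λ SA →
             Age SM (n , SA) × Σ (Ext C (n , SA)) (IsEnvelope C (n , SA))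

  StarLanguage : Language (lsuc lzero)
  StarLanguage = record
    { Sym   = Sym L ⊎ EnvSym
    ; arity = λ { (inj₁ R) → arity L R ; (inj₂ (n , _)) → n } }

  Star : Structure StarLanguage X
  rel Star (inj₁ R) t = rel SM R t
  rel Star (inj₂ (n , SA , _ , e , _)) t =
    Σ (IsEmb SA SM t) λ _ → Realizes SM {C} {n , SA} t e

Infinite : ∀ {a} → Set a → Set a
Infinite X = ¬ (Σ ℕ λ n → X ↔ Fin n)

{-# OPTIONS --safe #-}
-- Embeddings of M lift to embeddings of M*: by uniqueness of envelopes, whether a tuple
-- realizes a given envelope is invariant under embeddings of M.  A structure A* in
-- Age(M*) carries, on the tuple of all its elements, the relation R_(f,B) of the
-- envelope (f,B) of its L-reduct, so every embedding of A* into M* has the form h ∘ f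
-- with h ∈ Emb(B,M).  A colouring of Emb(A*,M*) therefore induces a colouring of
-- Emb(B,M); as B ∈ BRO(M) some g ∈ Emb(M) makes the latter constant on g ∘ Emb(B,M),
-- and the lift of g to M* makes the former constant on (lift g) ∘ Emb(A*,M*).
module Submission where

open import Defs
open import Level using (Level; zero; suc; _⊔_)
open import Data.Nat using (ℕ; _≤_)
open import Axiom.ExcludedMiddle using (ExcludedMiddle)
open import Data.Fin using (Fin) renaming (zero to fzero)
open import Data.Product using (Σ; _×_; _,_; proj₁; proj₂)
open import Data.Sum using (inj₁; inj₂)
open import Function using (_∘_; id)
open import Relation.Binary.PropositionalEquality using (_≡_; _≗_; refl; sym; trans; cong)
open import Relation.Nullary using (¬_; Dec; yes; no; contradiction)

module _ {ℓ : Level} {L : Language ℓ} where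

  IsEmb-cancelˡ : ∀ {a b c} {X : Set a} {Y : Set b} {Z : Set c}
                  {SX : Structure L X} {SY : Structure L Y} {SZ : Structure L Z}
                  {g : Y → Z} {t : X → Y} →
                  IsEmb SY SZ g → IsEmb SX SZ (g ∘ t) → IsEmb SX SY t
  IsEmb-cancelˡ {g = g} {t} (_ , g-rel) (gt-inj , gt-rel) =
    (λ x y eq → gt-inj x y (cong g eq)) ,
    (λ R u → (λ r → proj₂ (g-rel R (t ∘ u)) (proj₁ (gt-rel R u) r)) ,
             (λ r → proj₂ (gt-rel R u) (proj₁ (g-rel R (t ∘ u)) r)))

  ¬BRDAtMost0 : ∀ {a} {X : Set a} {SK : Structure L X} (A : FinStr L) →
                Age SK A → ¬ BRDAtMost 0 A SK
  ¬BRDAtMost0 A e brd0 with brd0 1 ((λ _ → fzero) , λ _ _ _ → refl)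
  ... | _ , _ , covered with covered e
  ... | () , _

  module _ {C : FinStr L → Set} {n : ℕ} {SA : Structure L (Fin n)} where

    realizes-∘ : ∀ {a b} {X : Set a} {Y : Set b} {SM : Structure L X} {SN : Structure L Y}
                 (g : Emb SM SN) {t : Fin n → X} (e : Ext C (n , SA)) →
                 Realizes SM t e → Realizes SN (proj₁ g ∘ t) e
    realizes-∘ {SM = SM} {SN} g ((_ , SB) , _) (h , t≗h∘f) =
      _∘E_ {SX = SB} {SY = SM} {SZ = SN} g h , cong (proj₁ g) ∘ t≗h∘f

    realizes-≅ : ∀ {a} {X : Set a} {SM : Structure L X} {t : Fin n → X}
                 (e d : Ext C (n , SA)) → e ≅Ext d → Realizes SM t d → Realizes SM t e
    realizes-≅ {SM = SM} ((_ , SB) , _) ((_ , SB′) , _) (σ , _ , σ∘f≗f′) (h , t≗h∘f′) =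
      _∘E_ {SX = SB} {SY = SB′} {SZ = SM} h σ ,
      λ x → trans (t≗h∘f′ x) (cong (proj₁ h) (sym (σ∘f≗f′ x)))

    realizes-reflect : ∀ {a} {X : Set a} {SM : Structure L X} → AdmitsEnvelopes SM C →
                       (g : Emb SM SM) (t : Emb SA SM) (e : Ext C (n , SA)) →
                       IsEnvelope C (n , SA) e →
                       Realizes SM (proj₁ g ∘ proj₁ t) e → Realizes SM (proj₁ t) e
    realizes-reflect {SM = SM} adm g t e e-env gt-real =
      let (d , d-env , t-real) = proj₁ (adm (n , SA) t t)
          gt = _∘E_ {SX = SA} {SY = SM} {SZ = SM} g t
          e≅d = proj₂ (adm (n , SA) t gt) e d e-env d-env gt-real
                      (realizes-∘ {SM = SM} {SN = SM} g d t-real)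
      in realizes-≅ {SM = SM} e d e≅d t-real

module _ {ℓ ℓ′ a} {L : Language ℓ} {L′ : Language ℓ′} {Y : Set a}
         {n m : ℕ} {SA : Structure L′ (Fin n)} {SK : Structure L′ Y}
         {SB : Structure L (Fin m)} {SM : Structure L Y}
         (lem : ExcludedMiddle (ℓ′ ⊔ a)) {r : ℕ}
         (χ : Colouring (n , SA) SK r) (f : Fin n → Fin m) (default : Fin r) where

  private
    FactorsThrough : Emb SB SM → Set (ℓ′ ⊔ a)
    FactorsThrough h = Σ (Emb SA SK) λ e → proj₁ e ≗ proj₁ h ∘ f

    colourVia : (h : Emb SB SM) → Dec (FactorsThrough h) → Fin r
    colourVia h (yes (e , _)) = proj₁ χ e
    colourVia h (no _)        = default

    colourVia-factor : (h : Emb SB SM) (d : Dec (FactorsThrough h))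
                       (e : Emb SA SK) → proj₁ e ≗ proj₁ h ∘ f → colourVia h d ≡ proj₁ χ e
    colourVia-factor h (yes (e′ , e′≗h∘f)) e e≗h∘f =
      proj₂ χ e′ e (λ x → trans (e′≗h∘f x) (sym (e≗h∘f x)))
    colourVia-factor h (no ¬factors) e e≗h∘f = contradiction (e , e≗h∘f) ¬factors

    colourVia-resp : ∀ h h′ → proj₁ h ≗ proj₁ h′ → colourVia h lem ≡ colourVia h′ lem
    colourVia-resp h h′ h≗h′ with lem {FactorsThrough h} | lem {FactorsThrough h′}
    ... | yes (e , e≗h∘f) | d′ =
      sym (colourVia-factor h′ d′ e (λ x → trans (e≗h∘f x) (h≗h′ (f x))))
    ... | no ¬factors | yes (e , e≗h′∘f) =
      contradiction (e , λ x → trans (e≗h′∘f x) (sym (h≗h′ (f x)))) ¬factors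
    ... | no _ | no _ = refl

  -- χB h is the colour of an embedding with underlying map h ∘ f if there is one (decided
  -- by excluded middle), and default otherwise.
  inducedColouring : Σ (Colouring (m , SB) SM r) λ χB →
                       ∀ h e → proj₁ e ≗ proj₁ h ∘ f → proj₁ χB h ≡ proj₁ χ e
  inducedColouring =
    ((λ h → colourVia h lem) , colourVia-resp) ,
    λ h e → colourVia-factor h lem e

module StarExpansion {L : Language zero} {X : Set} (M : Structure L X)
                     (C : FinStr L → Set) (adm : AdmitsEnvelopes M C) where

  L* : Language (suc zero)
  L* = StarLanguage M C

  M* : Structure L* X
  M* = Star M C

  liftEmb : Emb M M → Emb M* M*
  liftEmb (g , g-emb@(g-inj , g-rel)) = g , g-inj , lift-rel
    where
    lift-rel : (R : Sym L*) (t : Fin (arity L* R) → X) →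
               (rel M* R t → rel M* R (g ∘ t)) × (rel M* R (g ∘ t) → rel M* R t)
    lift-rel (inj₁ R) t = g-rel R t
    lift-rel (inj₂ (k , SA , _ , e , e-env)) t =
      (λ (t-emb , t-real) → proj₂ (_∘E_ {SX = SA} {SY = M} {SZ = M} (g , g-emb) (t , t-emb)) ,
                            realizes-∘ {SM = M} {SN = M} (g , g-emb) e t-real) ,
      (λ (gt-emb , gt-real) → let t-emb = IsEmb-cancelˡ {SX = SA} {SY = M} {SZ = M} g-emb gt-emb in
         t-emb , realizes-reflect adm (g , g-emb) (t , t-emb) e e-env gt-real)

  reduct : ∀ {Y : Set} → Structure L* Y → Structure L Y
  rel (reduct S) R = rel S (inj₁ R)

  reductEmb : ∀ {n} {SA : Structure L* (Fin n)} → Emb SA M* → Emb (reduct SA) M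
  reductEmb (e , e-inj , e-rel) = e , e-inj , λ R → e-rel (inj₁ R)

  -- A*'s relation R_(f,B) holds on its identity tuple, because e₀ reflects it.
  Emb-realizes-envelope : ∀ {n} {SA : Structure L* (Fin n)} (e₀ : Emb SA M*)
                          (ε : Ext C (n , reduct SA)) (ε-env : IsEnvelope C (n , reduct SA) ε) →
                          Realizes M (proj₁ e₀) ε →
                          (e : Emb SA M*) → Realizes M (proj₁ e) ε
  Emb-realizes-envelope {n} {SA} e₀ ε ε-env e₀-real (_ , _ , e-rel) =
    proj₂ (proj₁ (e-rel R id) (proj₂ (proj₂ (proj₂ e₀) R id) (proj₂ (reductEmb e₀) , e₀-real)))
    where
    R : Sym L*
    R = inj₂ (n , reduct SA , reductEmb e₀ , ε , ε-env)

  BRDAtMost1 : ExcludedMiddle (suc zero) → (∀ B → C B → BRDAtMost 1 B M) →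
               (A : FinStr L*) → Age M* A → BRDAtMost 1 A M*
  BRDAtMost1 lem C-Ramsey (n , SA) e₀ r χ
    with proj₁ (adm (n , reduct SA) (reductEmb e₀) (reductEmb e₀))
  ... | ε@((m , SB) , B∈C , f) , ε-env , e₀-real
    with inducedColouring {SK = M*} {SB = SB} {SM = M} lem χ (proj₁ f) (proj₁ χ e₀)
  ... | χB , χB-factor
    with C-Ramsey (m , SB) B∈C r χB
  ... | g , c , χB-const = liftEmb g , c , constant
    where
    constant : ∀ e → Σ (Fin 1) λ i → proj₁ χ (_∘E_ {SX = SA} {SY = M*} {SZ = M*} (liftEmb g) e) ≡ c i
    constant e =
      let (h , e≗h∘f) = Emb-realizes-envelope e₀ ε ε-env e₀-real e
          (i , χB≡c) = χB-const h
      in i , trans (sym (χB-factor (_∘E_ {SX = SB} {SY = M} {SZ = M} g h)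
                                   (_∘E_ {SX = SA} {SY = M*} {SZ = M*} (liftEmb g) e)
                                   (cong (proj₁ g) ∘ e≗h∘f)))
                   χB≡c

proposition3p21 : ExcludedMiddle (suc zero) →
    (L : Language zero) → (∀ (R : Sym L) → 1 ≤ arity L R) →
    (X : Set) (M : Structure L X) → Infinite X →
    (C : FinStr L → Set) → (∀ (B : FinStr L) → C B → BRO M B) →
    AdmitsEnvelopes M C →
    InfiniteRamsey (Star M C)
proposition3p21 lem L _ X M _ C C⊆BRO adm A A∈Age =
  A∈Age , BRDAtMost1 lem (λ B B∈C → proj₁ (proj₂ (C⊆BRO B B∈C))) A A∈Age , ¬BRDAtMost0 A A∈Age
  where open StarExpansion M C adm
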